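{- Let $G=(V,E)$ be a finite simple undirected graph and let $a\in V$ be a node with $\deg(a)=2$, say $\Gamma(a)=\{u,v\}$, such that $\{u,v\}\notin E$ and $\{a\}$ is not a separation clique of $G$. Then there exists a minimum triangulation $\hat T$ of $G$ with $\{u,v\}\in\hat T$ and $\{a,x\}\notin\hat T$ for all $x\in V$.
   Context: A graph is chordal (triangulated) if every cycle of four or more nodes has an edge joining two non-consecutive nodes of the cycle. A triangulation of $G=(V,E)$ is a set $T$ of pairs of nodes such that $(V,E\cup T)$ is chordal; it is a minimum triangulation if no triangulation has fewer elements. A set $S\subseteq V$ is a separation clique of $G$ if $S$ is a clique and $V\setminus S$ can be partitioned into two nonempty sets $V_1,V_2$ with no edge between $V_1$ and $V_2$. -}

module Defs where

open import Data.Nat using (ℕ; zero; suc; _≤_; _<ᵇ_; _+_)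
open import Data.Fin using (Fin; toℕ; _≟_)
open import Data.Bool using (Bool; true; false; _∧_; _∨_; if_then_else_)
open import Data.List using (List; map; cartesianProduct; allFin)
open import Data.Nat.ListAction using (sum)
open import Data.Product using (Σ; _×_; _,_; ∃; ∃-syntax)
open import Data.Sum using (_⊎_)
open import Relation.Binary.PropositionalEquality using (_≡_; _≢_)
open import Relation.Nullary using (¬_)
open import Relation.Nullary.Decidable using (⌊_⌋)
open import Function.Definitions using (Injective)

record Graph (n : ℕ) : Set where
  field
    Adj   : Fin n → Fin n → Bool
    sym   : ∀ x y → Adj x y ≡ Adj y x
    irref : ∀ x → Adj x x ≡ false
open Graph public

Rel : ℕ → Set
Rel n = Fin n → Fin n → Bool

Consecutive : (k : ℕ) → Fin k → Fin k → Set
Consecutive k i j =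
    suc (toℕ i) ≡ toℕ j
  ⊎ suc (toℕ j) ≡ toℕ i
  ⊎ (toℕ i ≡ 0 × suc (toℕ j) ≡ k)
  ⊎ (toℕ j ≡ 0 × suc (toℕ i) ≡ k)

IsCycle : ∀ {n} → Rel n → (k : ℕ) → (Fin k → Fin n) → Set
IsCycle R k c = Injective _≡_ _≡_ c × (∀ i j → Consecutive k i j → R (c i) (c j) ≡ true)

Chordal : ∀ {n} → Rel n → Set
Chordal {n} R = ∀ (k : ℕ) → 4 ≤ k → (c : Fin k → Fin n) → IsCycle R k c →
  ∃[ i ] ∃[ j ] (i ≢ j × ¬ Consecutive k i j × R (c i) (c j) ≡ true)

-- A set of (unordered) pairs of distinct nodes: symmetric irreflexive relation.
PairSet : ℕ → Set
PairSet n = Σ (Rel n) λ T → (∀ x y → T x y ≡ T y x) × (∀ x → T x x ≡ false)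

_∈ₚ_ : ∀ {n} → Fin n × Fin n → PairSet n → Set
(x , y) ∈ₚ (T , _) = T x y ≡ true

size : ∀ {n} → PairSet n → ℕ
size {n} (T , _) = sum (map (λ p → f p) (cartesianProduct (allFin n) (allFin n)))
  where
  f : Fin n × Fin n → ℕ
  f (i , j) = if (toℕ i <ᵇ toℕ j) ∧ T i j then 1 else 0

_∪E_ : ∀ {n} → Graph n → PairSet n → Rel n
(G ∪E (T , _)) x y = Adj G x y ∨ T x y

IsTriangulation : ∀ {n} → Graph n → PairSet n → Set
IsTriangulation G T = Chordal (G ∪E T)

IsMinimumTriangulation : ∀ {n} → Graph n → PairSet n → Set
IsMinimumTriangulation G T =
  IsTriangulation G T × (∀ T' → IsTriangulation G T' → size T ≤ size T')

-- Subsets of V as Boolean predicates.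
IsClique : ∀ {n} → Graph n → (Fin n → Bool) → Set
IsClique G S = ∀ x y → S x ≡ true → S y ≡ true → x ≢ y → Adj G x y ≡ true

IsSeparationClique : ∀ {n} → Graph n → (Fin n → Bool) → Set
IsSeparationClique {n} G S = IsClique G S ×
  Σ (Fin n → Bool) λ side → (  (∃[ x ] (S x ≡ false × side x ≡ true))
             × (∃[ y ] (S y ≡ false × side y ≡ false))
             × (∀ x y → S x ≡ false → S y ≡ false → side x ≡ true → side y ≡ false →
                  Adj G x y ≡ false))

singleton : ∀ {n} → Fin n → Fin n → Bool
singleton a x = ⌊ x ≟ a ⌋

module Submission where

-- Take any minimum triangulation T, put H = E ∪ T, and let T̂ drop every fill edge at a and instead join
-- u to those H-neighbours of a that are not yet H-adjacent to u. Away from a, E ∪ T̂ is H with the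
-- edge au contracted, and contracting an edge preserves chordality; at a, the only neighbours u and v
-- are adjacent, so E ∪ T̂ is chordal. Each new fill edge at u other than uv replaces the fill edge from
-- a to the same vertex. If uv is new, a also has a fill neighbour w adjacent to u, which pays for it:
-- as {a} does not separate u from v, some H-neighbour of a other than u is reachable from u in H - a,
-- and a nearest one is adjacent to u, since a shortest path to it closes with a into a hole otherwise.

open import Defs hiding (sym)
open import Data.Bool using (Bool; true; false; _∧_; _∨_; not; if_then_else_)
import Data.Bool.Properties as Bool
open import Data.Empty using (⊥; ⊥-elim)
open import Data.Fin using (Fin; zero; suc; toℕ; fromℕ; fromℕ<; _≟_; finToFun; funToFin)
open import Data.Fin.Properties
  using (toℕ-fromℕ<; toℕ-fromℕ; toℕ<n; toℕ-injective; punchInᵢ≢i; any?; all?; finToFun-funToFin; pigeonhole)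
import Data.Fin.Properties as Fin
open import Data.List as L using (List; _++_; map; tabulate; allFin; cartesianProduct)
open import Data.List.Properties using (map-tabulate; map-++; map-∘)
open import Data.Nat using (ℕ; zero; suc; _+_; _^_; _<ᵇ_; _≤_; _<_; z≤n; s≤s; s≤s⁻¹; _<?_; _≤?_)
open import Data.Nat.Induction using (<-rec)
open import Data.Nat.ListAction using () renaming (sum to listSum)
open import Data.Nat.ListAction.Properties using (sum-++)
open import Data.Nat.Properties
  using (≤-refl; ≤-trans; ≤-reflexive; ≤-antisym; ≮⇒≥; ≰⇒>; <-irrefl; <-cmp; ≤∧≢⇒<; m≤n⇒m<n∨m≡n; m<n⇒m<1+n;
         n≢0⇒n>0; suc-injective; 0≢1+n; 1+n≢n; +-mono-≤; +-monoʳ-≤; +-identityʳ; +-cancelʳ-≤; m≤n+m;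
         <⇒<ᵇ; <ᵇ⇒<; anyUpTo?; allUpTo?; +-0-commutativeMonoid; module ≤-Reasoning)
  renaming (_≟_ to _≟ℕ_)
open import Algebra.Properties.CommutativeMonoid.Sum +-0-commutativeMonoid
  using (sum; sum-syntax; sum-cong-≗; sum-remove; sum-replicate-zero; ∑-distrib-+)
open import Data.Product using (_×_; _,_; proj₁; proj₂; ∃; ∃-syntax)
open import Data.Sum using (_⊎_; inj₁; inj₂; swap; [_,_])
open import Data.Vec.Functional using (_∷_; removeAt)
open import Function using (_∘_; id)
open import Function.Bundles using (Equivalence)
open import Function.Definitions using (Injective)
open import Relation.Binary using (tri<; tri≈; tri>)
open import Relation.Binary.PropositionalEquality
  using (_≡_; _≢_; _≗_; refl; sym; trans; cong; cong₂; subst; subst₂; module ≡-Reasoning)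
open import Relation.Nullary using (¬_; Dec; yes; no; ¬¬-excluded-middle)
open import Relation.Nullary.Decidable
  using (⌊_⌋; dec-true; dec-false; isYes≗does; _⊎-dec_; _×-dec_; _→-dec_; ¬?; map′; decidable-stable)

⌊⌋-true : ∀ {A : Set} (d : Dec A) → A → ⌊ d ⌋ ≡ true
⌊⌋-true d a = trans (isYes≗does d) (dec-true d a)

⌊⌋-false : ∀ {A : Set} (d : Dec A) → ¬ A → ⌊ d ⌋ ≡ false
⌊⌋-false d ¬a = trans (isYes≗does d) (dec-false d ¬a)

⌊⌋-sound : ∀ {A : Set} (d : Dec A) → ⌊ d ⌋ ≡ true → A
⌊⌋-sound (yes a) _ = a

_==_ : ∀ {n} → Fin n → Fin n → Bool
x == y = ⌊ x ≟ y ⌋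

∨-elim : ∀ {b c} → (b ∨ c) ≡ true → b ≡ true ⊎ c ≡ true
∨-elim {true}  _ = inj₁ refl
∨-elim {false} e = inj₂ e

∨-introˡ : ∀ {b} c → b ≡ true → (b ∨ c) ≡ true
∨-introˡ c refl = refl

∨-introʳ : ∀ b {c} → c ≡ true → (b ∨ c) ≡ true
∨-introʳ b refl = Bool.∨-zeroʳ b

≡true⇒≢false : ∀ {b} → b ≡ true → b ≢ false
≡true⇒≢false refl ()

==-sym : ∀ {n} (x y : Fin n) → (x == y) ≡ (y == x)
==-sym x y with x ≟ y | y ≟ x
... | yes _   | yes _   = refl
... | no _    | no _    = refl
... | yes x≡y | no y≢x  = ⊥-elim (y≢x (sym x≡y))
... | no x≢y  | yes y≡x = ⊥-elim (x≢y (sym y≡x))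

¬¬-decide : ∀ {n} (P : Fin n → Set) → ¬ ¬ (∀ x → Dec (P x))
¬¬-decide {zero}  P k = k λ ()
¬¬-decide {suc n} P k =
  ¬¬-excluded-middle λ d₀ → ¬¬-decide (P ∘ suc) λ ds → k λ { zero → d₀ ; (suc x) → ds x }

least : ∀ {P : ℕ → Set} → (∀ i → Dec (P i)) → ∀ {N} → P N → ∃[ i ] (P i × (∀ {j} → j < i → ¬ P j))
least {P} P? {N} = <-rec (λ N → P N → ∃[ i ] (P i × (∀ {j} → j < i → ¬ P j))) search N
  where
  search : ∀ N → (∀ {M} → M < N → P M → ∃[ i ] (P i × (∀ {j} → j < i → ¬ P j))) →
           P N → ∃[ i ] (P i × (∀ {j} → j < i → ¬ P j))
  search N rec pN with anyUpTo? P? N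
  ... | yes (M , M<N , pM) = rec M<N pM
  ... | no none            = N , pN , λ j<N pj → none (_ , j<N , pj)

HasChord : ∀ {n} → Rel n → (k : ℕ) → (Fin k → Fin n) → Set
HasChord R k c = ∃[ i ] ∃[ j ] (i ≢ j × ¬ Consecutive k i j × R (c i) (c j) ≡ true)

consecutive-sym : ∀ {k} {i j : Fin k} → Consecutive k i j → Consecutive k j i
consecutive-sym (inj₁ e)                 = inj₂ (inj₁ e)
consecutive-sym (inj₂ (inj₁ e))          = inj₁ e
consecutive-sym (inj₂ (inj₂ (inj₁ w)))   = inj₂ (inj₂ (inj₂ w))
consecutive-sym (inj₂ (inj₂ (inj₂ w)))   = inj₂ (inj₂ (inj₁ w))

consecutive? : ∀ k (i j : Fin k) → Dec (Consecutive k i j)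
consecutive? k i j =
  (suc (toℕ i) ≟ℕ toℕ j) ⊎-dec (suc (toℕ j) ≟ℕ toℕ i) ⊎-dec
  ((toℕ i ≟ℕ 0) ×-dec (suc (toℕ j) ≟ℕ k)) ⊎-dec ((toℕ j ≟ℕ 0) ×-dec (suc (toℕ i) ≟ℕ k))

next : ∀ {k} → Fin (suc k) → Fin (suc k)
next {k} i with suc (toℕ i) <? suc k
... | yes i+1<k = fromℕ< i+1<k
... | no  _     = zero

next-cases : ∀ {k} (i : Fin (suc k)) →
  toℕ (next i) ≡ suc (toℕ i) ⊎ (toℕ (next i) ≡ 0 × suc (toℕ i) ≡ suc k)
next-cases {k} i with suc (toℕ i) <? suc k
... | yes i+1<k = inj₁ (toℕ-fromℕ< i+1<k)
... | no  i+1≮k = inj₂ (refl , ≤-antisym (toℕ<n i) (≮⇒≥ i+1≮k))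

consecutive-next : ∀ {k} (i : Fin (suc k)) → Consecutive (suc k) i (next i)
consecutive-next i with next-cases i
... | inj₁ e           = inj₁ (sym e)
... | inj₂ (e , last)  = inj₂ (inj₂ (inj₂ (e , last)))

next-unique : ∀ {k} {i j : Fin (suc k)} →
  suc (toℕ i) ≡ toℕ j ⊎ (toℕ j ≡ 0 × suc (toℕ i) ≡ suc k) → j ≡ next i
next-unique {i = i} {j} (inj₁ e) with next-cases i
... | inj₁ e′          = toℕ-injective (trans (sym e) (sym e′))
... | inj₂ (_ , last)  = ⊥-elim (<-irrefl (trans (sym e) last) (toℕ<n j))
next-unique {i = i} {j} (inj₂ (j≡0 , last)) with next-cases i
... | inj₁ e′          = ⊥-elim (<-irrefl (trans e′ last) (toℕ<n (next i)))
... | inj₂ (e′ , _)    = toℕ-injective (trans j≡0 (sym e′))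

consecutive⇒next : ∀ {k} {i j : Fin (suc k)} → Consecutive (suc k) i j → j ≡ next i ⊎ i ≡ next j
consecutive⇒next (inj₁ e)               = inj₁ (next-unique (inj₁ e))
consecutive⇒next (inj₂ (inj₁ e))        = inj₂ (next-unique (inj₁ e))
consecutive⇒next (inj₂ (inj₂ (inj₁ w))) = inj₂ (next-unique (inj₂ w))
consecutive⇒next (inj₂ (inj₂ (inj₂ w))) = inj₁ (next-unique (inj₂ w))

next⇒consecutive : ∀ {k} {i j : Fin (suc k)} → j ≡ next i ⊎ i ≡ next j → Consecutive (suc k) i j
next⇒consecutive {i = i} (inj₁ refl) = consecutive-next i
next⇒consecutive {j = j} (inj₂ refl) = consecutive-sym (consecutive-next j)

next-injective : ∀ {k} {i j : Fin (suc k)} → next i ≡ next j → i ≡ j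
next-injective {i = i} {j} e with next-cases i | next-cases j
... | inj₁ ei        | inj₁ ej        = toℕ-injective (suc-injective (trans (sym ei) (trans (cong toℕ e) ej)))
... | inj₂ (_ , li)  | inj₂ (_ , lj)  = toℕ-injective (suc-injective (trans li (sym lj)))
... | inj₁ ei        | inj₂ (zj , _)  = ⊥-elim (0≢1+n (trans (sym zj) (trans (sym (cong toℕ e)) ei)))
... | inj₂ (zi , _)  | inj₁ ej        = ⊥-elim (0≢1+n (trans (sym zi) (trans (cong toℕ e) ej)))

next-last : ∀ k → next (fromℕ k) ≡ zero
next-last k = sym (next-unique (inj₂ (refl , cong suc (toℕ-fromℕ k))))

next-zero : ∀ k → next {suc k} zero ≡ suc zero
next-zero k = sym (next-unique (inj₁ refl))

rotate : ∀ {k} → ℕ → Fin (suc k) → Fin (suc k)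
rotate zero    i = i
rotate (suc m) i = next (rotate m i)

rotate-next : ∀ {k} m (i : Fin (suc k)) → rotate m (next i) ≡ next (rotate m i)
rotate-next zero    i = refl
rotate-next (suc m) i = cong next (rotate-next m i)

rotate-injective : ∀ {k} m {i j : Fin (suc k)} → rotate m i ≡ rotate m j → i ≡ j
rotate-injective zero    e = e
rotate-injective (suc m) e = rotate-injective m (next-injective e)

toℕ-rotate-zero : ∀ {k} m → m < suc k → toℕ (rotate {k} m zero) ≡ m
toℕ-rotate-zero zero    _         = refl
toℕ-rotate-zero (suc m) (s≤s m<k) with next-cases (rotate m zero)
... | inj₁ e          = trans e (cong suc (toℕ-rotate-zero m (m<n⇒m<1+n m<k)))
... | inj₂ (_ , last) =
  ⊥-elim (<-irrefl (trans (cong suc (sym (toℕ-rotate-zero m (m<n⇒m<1+n m<k)))) last) (s≤s m<k))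

rotate-zero : ∀ {k} (p : Fin (suc k)) → rotate (toℕ p) zero ≡ p
rotate-zero p = toℕ-injective (toℕ-rotate-zero (toℕ p) (toℕ<n p))

consecutive-rotate : ∀ {k} m {i j : Fin (suc k)} →
  Consecutive (suc k) i j → Consecutive (suc k) (rotate m i) (rotate m j)
consecutive-rotate m c with consecutive⇒next c
... | inj₁ refl = next⇒consecutive (inj₁ (rotate-next m _))
... | inj₂ refl = next⇒consecutive (inj₂ (rotate-next m _))

consecutive-unrotate : ∀ {k} m {i j : Fin (suc k)} →
  Consecutive (suc k) (rotate m i) (rotate m j) → Consecutive (suc k) i j
consecutive-unrotate m c with consecutive⇒next c
... | inj₁ e = next⇒consecutive (inj₁ (rotate-injective m (trans e (sym (rotate-next m _)))))
... | inj₂ e = next⇒consecutive (inj₂ (rotate-injective m (trans e (sym (rotate-next m _)))))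

rotate-isCycle : ∀ {n k} {R : Rel n} {c : Fin (suc k) → Fin n} m →
  IsCycle R (suc k) c → IsCycle R (suc k) (c ∘ rotate m)
rotate-isCycle m (inj , edge) = rotate-injective m ∘ inj , λ i j → edge _ _ ∘ consecutive-rotate m

unrotate-chord : ∀ {n k} {R : Rel n} {c : Fin (suc k) → Fin n} m →
  HasChord R (suc k) (c ∘ rotate m) → HasChord R (suc k) c
unrotate-chord m (i , j , i≢j , ¬ij , r) =
  rotate m i , rotate m j , i≢j ∘ rotate-injective m , ¬ij ∘ consecutive-unrotate m , r

chordal-intro : ∀ {n} {R : Rel n} →
  (∀ k (c : Fin (4 + k) → Fin n) → IsCycle R (4 + k) c → HasChord R (4 + k) c) → Chordal R
chordal-intro h .(4 + k) (s≤s (s≤s (s≤s (s≤s (z≤n {k}))))) = h k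

chordal-elim : ∀ {n} {R : Rel n} → Chordal R →
  ∀ k (c : Fin (4 + k) → Fin n) → IsCycle R (4 + k) c → HasChord R (4 + k) c
chordal-elim ch k = ch (4 + k) (s≤s (s≤s (s≤s (s≤s z≤n))))

consecutive-irreflexive : ∀ {k} (i : Fin (suc (suc k))) → ¬ Consecutive (suc (suc k)) i i
consecutive-irreflexive i (inj₁ e)                       = 1+n≢n e
consecutive-irreflexive i (inj₂ (inj₁ e))                = 1+n≢n e
consecutive-irreflexive i (inj₂ (inj₂ (inj₁ (z , l))))   = 0≢1+n (suc-injective (trans (cong suc (sym z)) l))
consecutive-irreflexive i (inj₂ (inj₂ (inj₂ (z , l))))   = 0≢1+n (suc-injective (trans (cong suc (sym z)) l))

neighbours-zero : ∀ {k} {j : Fin (4 + k)} → Consecutive (4 + k) zero j → j ≡ suc zero ⊎ j ≡ fromℕ (3 + k)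
neighbours-zero (inj₁ e)                     = inj₁ (toℕ-injective (sym e))
neighbours-zero (inj₂ (inj₂ (inj₁ (_ , l)))) =
  inj₂ (toℕ-injective (trans (suc-injective l) (sym (toℕ-fromℕ _))))

neighbours-zero-elim : ∀ {k} (P : Fin (4 + k) → Set) → P (suc zero) → P (fromℕ (3 + k)) →
  ∀ j → Consecutive (4 + k) zero j → P j
neighbours-zero-elim P p₁ pₗ j cj with neighbours-zero cj
... | inj₁ refl = p₁
... | inj₂ refl = pₗ

one≢last : ∀ {k} → suc zero ≢ fromℕ (3 + k)
one≢last ()

one-last-nonconsecutive : ∀ {k} → ¬ Consecutive (4 + k) (suc zero) (fromℕ (3 + k))
one-last-nonconsecutive (inj₁ ())
one-last-nonconsecutive (inj₂ (inj₁ ()))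
one-last-nonconsecutive (inj₂ (inj₂ (inj₁ (() , _))))
one-last-nonconsecutive (inj₂ (inj₂ (inj₂ (() , _))))

simplicial-chord : ∀ {n k} {R : Rel n} {a : Fin n} {c : Fin (4 + k) → Fin n} →
  (∀ x y → x ≢ y → R a x ≡ true → R a y ≡ true → R x y ≡ true) →
  IsCycle R (4 + k) c → c zero ≡ a → HasChord R (4 + k) c
simplicial-chord {k = k} clique (inj , edge) refl =
  suc zero , fromℕ (3 + k) , one≢last , one-last-nonconsecutive ,
  clique _ _ (one≢last ∘ inj {suc zero} {fromℕ (3 + k)})
         (edge _ _ (inj₁ refl)) (edge _ _ (inj₂ (inj₂ (inj₁ (refl , cong suc (toℕ-fromℕ _))))))

chordal-by-vertex : ∀ {n} {R : Rel n} (a : Fin n) →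
  (∀ k (c : Fin (4 + k) → Fin n) → IsCycle R (4 + k) c → c zero ≡ a → HasChord R (4 + k) c) →
  (∀ k (c : Fin (4 + k) → Fin n) → IsCycle R (4 + k) c → (∀ i → c i ≢ a) → HasChord R (4 + k) c) →
  Chordal R
chordal-by-vertex {R = R} a through avoiding =
  chordal-intro {R = R} λ k c cyc → locate k c cyc (any? (λ i → c i ≟ a))
  where
  locate : ∀ k c → IsCycle R (4 + k) c → Dec (∃ λ i → c i ≡ a) → HasChord R (4 + k) c
  locate k c cyc (yes (p , cp)) =
    unrotate-chord {R = R} {c = c} (toℕ p)
      (through k (c ∘ rotate (toℕ p)) (rotate-isCycle {R = R} (toℕ p) cyc) (trans (cong c (rotate-zero p)) cp))
  locate k c cyc (no none) = avoiding k c cyc λ i e → none (i , e)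

chordal-cong : ∀ {n} {R S : Rel n} → (∀ x y → R x y ≡ S x y) → Chordal R → Chordal S
chordal-cong R≡S ch k 4≤k c (inj , edge)
  with ch k 4≤k c (inj , λ i j cij → trans (R≡S (c i) (c j)) (edge i j cij))
... | i , j , i≢j , ¬c , r = i , j , i≢j , ¬c , trans (sym (R≡S (c i) (c j))) r

chordal-avoiding-transfer : ∀ {n} {R S : Rel n} {a : Fin n} →
  (∀ x y → x ≢ y → x ≢ a → y ≢ a → R x y ≡ S x y) →
  (∀ k (c : Fin (4 + k) → Fin n) → IsCycle S (4 + k) c → (∀ i → c i ≢ a) → HasChord S (4 + k) c) →
  ∀ k (c : Fin (4 + k) → Fin n) → IsCycle R (4 + k) c → (∀ i → c i ≢ a) → HasChord R (4 + k) c
chordal-avoiding-transfer {R = R} {S} agree chorded k c (inj , edge) c≢a = lift (chorded k c (inj , S-edge) c≢a)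
  where
  agree-on : ∀ i j → i ≢ j → R (c i) (c j) ≡ S (c i) (c j)
  agree-on i j i≢j = agree (c i) (c j) (i≢j ∘ inj) (c≢a i) (c≢a j)
  S-edge : ∀ i j → Consecutive (4 + k) i j → S (c i) (c j) ≡ true
  S-edge i j cij = trans (sym (agree-on i j λ { refl → consecutive-irreflexive i cij })) (edge i j cij)
  lift : HasChord S (4 + k) c → HasChord R (4 + k) c
  lift (i , j , i≢j , ¬c , r) = i , j , i≢j , ¬c , trans (agree-on i j i≢j) r

complete-chordal : ∀ {n} {R : Rel n} → (∀ x y → x ≢ y → R x y ≡ true) → Chordal R
complete-chordal {R = R} complete = chordal-intro {R = R} λ k c (inj , _) →
  zero , suc (suc zero) , zero≢two , zero-two-nonconsecutive ,
  complete (c zero) (c (suc (suc zero))) (zero≢two ∘ inj {zero} {suc (suc zero)})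
  where
  zero-two-nonconsecutive : ∀ {k} → ¬ Consecutive (4 + k) zero (suc (suc zero))
  zero-two-nonconsecutive (inj₁ ())
  zero-two-nonconsecutive (inj₂ (inj₁ ()))
  zero-two-nonconsecutive (inj₂ (inj₂ (inj₁ (_ , ()))))
  zero-two-nonconsecutive (inj₂ (inj₂ (inj₂ (() , _))))
  zero≢two : ∀ {k} → _≢_ {A = Fin (4 + k)} zero (suc (suc zero))
  zero≢two ()

-- Closing a path into a cycle through a new vertex

2≢3+k : ∀ {k} → 2 ≢ 3 + k
2≢3+k ()

PathConsecutive : (k : ℕ) → Fin k → Fin k → Set
PathConsecutive k i j = suc (toℕ i) ≡ toℕ j ⊎ suc (toℕ j) ≡ toℕ i

End : (k : ℕ) → Fin k → Set
End k j = toℕ j ≡ 0 ⊎ suc (toℕ j) ≡ k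

fromℕ-end : ∀ k → End (suc k) (fromℕ k)
fromℕ-end k = inj₂ (cong suc (toℕ-fromℕ k))

path⇒consecutive : ∀ {k} {i j : Fin k} → PathConsecutive k i j → Consecutive k i j
path⇒consecutive (inj₁ e) = inj₁ e
path⇒consecutive (inj₂ e) = inj₂ (inj₁ e)

consecutive⇒path⊎ends : ∀ {k} {i j : Fin k} → Consecutive k i j → PathConsecutive k i j ⊎ (End k i × End k j)
consecutive⇒path⊎ends (inj₁ e)                     = inj₁ (inj₁ e)
consecutive⇒path⊎ends (inj₂ (inj₁ e))              = inj₁ (inj₂ e)
consecutive⇒path⊎ends (inj₂ (inj₂ (inj₁ (z , l)))) = inj₂ (inj₁ z , inj₂ l)
consecutive⇒path⊎ends (inj₂ (inj₂ (inj₂ (z , l)))) = inj₂ (inj₂ l , inj₁ z)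

ends-consecutive : ∀ {k} {q r : Fin k} → End k q → End k r → q ≢ r → Consecutive k q r
ends-consecutive (inj₁ q0) (inj₁ r0) q≢r = ⊥-elim (q≢r (toℕ-injective (trans q0 (sym r0))))
ends-consecutive (inj₁ q0) (inj₂ rl) _   = inj₂ (inj₂ (inj₁ (q0 , rl)))
ends-consecutive (inj₂ ql) (inj₁ r0) _   = inj₂ (inj₂ (inj₂ (r0 , ql)))
ends-consecutive (inj₂ ql) (inj₂ rl) q≢r = ⊥-elim (q≢r (toℕ-injective (suc-injective (trans ql (sym rl)))))

end-cases : ∀ {k} {q r j : Fin k} → End k q → End k r → q ≢ r → End k j → j ≡ q ⊎ j ≡ r
end-cases (inj₁ q0) _         _   (inj₁ j0) = inj₁ (toℕ-injective (trans j0 (sym q0)))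
end-cases _         (inj₁ r0) _   (inj₁ j0) = inj₂ (toℕ-injective (trans j0 (sym r0)))
end-cases (inj₂ ql) _         _   (inj₂ jl) = inj₁ (toℕ-injective (suc-injective (trans jl (sym ql))))
end-cases _         (inj₂ rl) _   (inj₂ jl) = inj₂ (toℕ-injective (suc-injective (trans jl (sym rl))))
end-cases (inj₂ ql) (inj₂ rl) q≢r (inj₁ _)  = ⊥-elim (q≢r (toℕ-injective (suc-injective (trans ql (sym rl)))))
end-cases (inj₁ q0) (inj₁ r0) q≢r (inj₂ _)  = ⊥-elim (q≢r (toℕ-injective (trans q0 (sym r0))))

ends-¬pathConsecutive : ∀ {k} {q r : Fin (3 + k)} → End (3 + k) q → End (3 + k) r → q ≢ r →
  ¬ PathConsecutive (3 + k) q r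
ends-¬pathConsecutive (inj₁ q0) (inj₁ r0) q≢r _ = q≢r (toℕ-injective (trans q0 (sym r0)))
ends-¬pathConsecutive (inj₂ ql) (inj₂ rl) q≢r _ = q≢r (toℕ-injective (suc-injective (trans ql (sym rl))))
ends-¬pathConsecutive (inj₁ q0) (inj₂ rl) _ (inj₁ e) =
  2≢3+k (trans (cong (2 +_) (sym q0)) (trans (cong suc e) rl))
ends-¬pathConsecutive (inj₁ q0) (inj₂ rl) _ (inj₂ e) = 0≢1+n (trans (sym q0) (sym e))
ends-¬pathConsecutive (inj₂ ql) (inj₁ r0) _ (inj₁ e) = 0≢1+n (trans (sym r0) (sym e))
ends-¬pathConsecutive (inj₂ ql) (inj₁ r0) _ (inj₂ e) =
  2≢3+k (trans (cong (2 +_) (sym r0)) (trans (cong suc e) ql))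

consecutive-zero-suc : ∀ {k} {j : Fin k} → Consecutive (suc k) zero (suc j) → End k j
consecutive-zero-suc (inj₁ e)                     = inj₁ (sym (suc-injective e))
consecutive-zero-suc (inj₂ (inj₂ (inj₁ (_ , l)))) = inj₂ (suc-injective l)

end⇒consecutive-zero-suc : ∀ {k} {j : Fin k} → End k j → Consecutive (suc k) zero (suc j)
end⇒consecutive-zero-suc (inj₁ j0) = inj₁ (cong suc (sym j0))
end⇒consecutive-zero-suc (inj₂ jl) = inj₂ (inj₂ (inj₁ (refl , cong suc jl)))

consecutive-suc-suc : ∀ {k} {i j : Fin k} → Consecutive (suc k) (suc i) (suc j) → PathConsecutive k i j
consecutive-suc-suc (inj₁ e)        = inj₁ (suc-injective e)
consecutive-suc-suc (inj₂ (inj₁ e)) = inj₂ (suc-injective e)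
consecutive-suc-suc (inj₂ (inj₂ (inj₁ (() , _))))
consecutive-suc-suc (inj₂ (inj₂ (inj₂ (() , _))))

path⇒consecutive-suc-suc : ∀ {k} {i j : Fin k} → PathConsecutive k i j → Consecutive (suc k) (suc i) (suc j)
path⇒consecutive-suc-suc (inj₁ e) = inj₁ (cong suc e)
path⇒consecutive-suc-suc (inj₂ e) = inj₂ (inj₁ (cong suc e))

module _ {n} {R : Rel n} (R-sym : ∀ x y → R x y ≡ R y x) {a : Fin n} where

  cons-isCycle : ∀ {k} {p : Fin (suc k) → Fin n} → Injective _≡_ _≡_ p → (∀ i → p i ≢ a) →
    (∀ i j → PathConsecutive (suc k) i j → R (p i) (p j) ≡ true) →
    (∀ j → End (suc k) j → R a (p j) ≡ true) →
    IsCycle R (suc (suc k)) (a ∷ p)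
  cons-isCycle {p = p} p-inj p≢a path ends = inj , edge
    where
    inj : Injective _≡_ _≡_ (a ∷ p)
    inj {zero}  {zero}  _ = refl
    inj {zero}  {suc j} e = ⊥-elim (p≢a j (sym e))
    inj {suc i} {zero}  e = ⊥-elim (p≢a i e)
    inj {suc i} {suc j} e = cong suc (p-inj e)
    edge : ∀ i j → Consecutive _ i j → R ((a ∷ p) i) ((a ∷ p) j) ≡ true
    edge zero    zero    c = ⊥-elim (consecutive-irreflexive zero c)
    edge zero    (suc j) c = ends j (consecutive-zero-suc c)
    edge (suc i) zero    c = trans (R-sym (p i) a) (ends i (consecutive-zero-suc (consecutive-sym c)))
    edge (suc i) (suc j) c = path i j (consecutive-suc-suc c)

  cons-chord-cases : ∀ {k} {p : Fin (suc k) → Fin n} → HasChord R (suc (suc k)) (a ∷ p) →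
    (∃[ j ] (¬ End (suc k) j × R a (p j) ≡ true)) ⊎
    (∃[ i ] ∃[ j ] (i ≢ j × ¬ PathConsecutive (suc k) i j × R (p i) (p j) ≡ true))
  cons-chord-cases (zero  , zero  , i≢j , _  , _) = ⊥-elim (i≢j refl)
  cons-chord-cases (zero  , suc j , _   , ¬c , r) = inj₁ (j , ¬c ∘ end⇒consecutive-zero-suc , r)
  cons-chord-cases {p = p} (suc i , zero , _ , ¬c , r) =
    inj₁ (i , ¬c ∘ consecutive-sym ∘ end⇒consecutive-zero-suc , trans (R-sym a (p i)) r)
  cons-chord-cases (suc i , suc j , i≢j , ¬c , r) =
    inj₂ (i , j , i≢j ∘ cong suc , ¬c ∘ path⇒consecutive-suc-suc , r)

no-hole : ∀ {n k} {H : Rel n} → (∀ x y → H x y ≡ H y x) → Chordal H →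
  ∀ {a : Fin n} (p : Fin (3 + k) → Fin n) → Injective _≡_ _≡_ p → (∀ i → p i ≢ a) →
  (∀ i j → PathConsecutive (3 + k) i j → H (p i) (p j) ≡ true) →
  (∀ i j → i ≢ j → ¬ PathConsecutive (3 + k) i j → H (p i) (p j) ≡ false) →
  (∀ j → End (3 + k) j → H a (p j) ≡ true) → (∀ j → ¬ End (3 + k) j → H a (p j) ≡ false) → ⊥
no-hole {k = k} {H} H-sym H-chordal {a} p inj p≢a path nonpath end inner
  with cons-chord-cases H-sym {p = p}
         (chordal-elim {R = H} H-chordal k (a ∷ p) (cons-isCycle H-sym inj p≢a path end))
... | inj₁ (j , ¬end , h) = ≡true⇒≢false h (inner j ¬end)
... | inj₂ (i , j , i≢j , ¬pc , h) = ≡true⇒≢false h (nonpath i j i≢j ¬pc)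

-- Contracting the vertex a into u

contract : ∀ {n} → Rel n → Fin n → Fin n → Rel n
contract H a u x y = H x y ∨ (x == u ∧ H a y) ∨ (y == u ∧ H a x)

module Contract {n} (H : Rel n) (a u : Fin n) where

  contract-⊇ : ∀ {x y} → H x y ≡ true → contract H a u x y ≡ true
  contract-⊇ = ∨-introˡ _

  contract-away : ∀ {x y} → x ≢ u → y ≢ u → contract H a u x y ≡ H x y
  contract-away {x} {y} x≢u y≢u rewrite ⌊⌋-false (x ≟ u) x≢u | ⌊⌋-false (y ≟ u) y≢u =
    Bool.∨-identityʳ (H x y)

  contract-at : ∀ {y} → H a y ≡ true → contract H a u u y ≡ true
  contract-at {y} h rewrite ⌊⌋-true (u ≟ u) refl | h = ∨-introʳ (H u y) refl

  contract-at⁻ : ∀ {y} → y ≢ u → contract H a u u y ≡ true → H u y ≡ true ⊎ H a y ≡ true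
  contract-at⁻ {y} y≢u e
    rewrite ⌊⌋-true (u ≟ u) refl | ⌊⌋-false (y ≟ u) y≢u | Bool.∨-identityʳ (H a y) = ∨-elim e

module ContractionChordal {n} {H : Rel n} (H-sym : ∀ x y → H x y ≡ H y x) (H-chordal : Chordal H)
                          {a u : Fin n} (H-au : H a u ≡ true) where

  open Contract H a u

  private
    C : Rel n
    C = contract H a u

  replace-head-chord : ∀ {k} (c : Fin (4 + k) → Fin n) → IsCycle C (4 + k) c → c zero ≡ u →
    (w : Fin n) → (∀ y → H w y ≡ true → C u y ≡ true) → (∀ i → c (suc i) ≢ w) →
    (∀ j → Consecutive (4 + k) zero j → H w (c j) ≡ true) → HasChord C (4 + k) c
  replace-head-chord {k} c (inj , edge) c0 w lift c≢w around
    with cons-chord-cases H-sym (chordal-elim {R = H} H-chordal k (w ∷ (c ∘ suc)) cycle)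
    where
    tail-edge : ∀ i j → PathConsecutive (3 + k) i j → H (c (suc i)) (c (suc j)) ≡ true
    tail-edge i j pc = trans (sym (contract-away (away i) (away j))) (edge _ _ (path⇒consecutive-suc-suc pc))
      where
      away : ∀ i → c (suc i) ≢ u
      away i e = Fin.0≢1+n (sym (inj (trans e (sym c0))))
    cycle : IsCycle H (4 + k) (w ∷ (c ∘ suc))
    cycle = cons-isCycle H-sym {a = w} {p = c ∘ suc} (Fin.suc-injective ∘ inj) c≢w tail-edge
                         (λ j → around (suc j) ∘ end⇒consecutive-zero-suc)
  ... | inj₁ (j , ¬end , h) =
    zero , suc j , (λ ()) , ¬end ∘ consecutive-zero-suc , subst (λ x → C x (c (suc j)) ≡ true) (sym c0) (lift _ h)
  ... | inj₂ (i , j , i≢j , ¬pc , h) =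
    suc i , suc j , i≢j ∘ Fin.suc-injective , ¬pc ∘ consecutive-suc-suc , contract-⊇ h

  neighbour-of-u : ∀ {k} {c : Fin (suc (suc k)) → Fin n} → IsCycle C (suc (suc k)) c →
    ∀ {q j} → c q ≡ u → Consecutive (suc (suc k)) q j → H u (c j) ≡ true ⊎ H a (c j) ≡ true
  neighbour-of-u {c = c} (inj , edge) {q} {j} cq cj =
    contract-at⁻ (λ e → consecutive-irreflexive q (subst (Consecutive _ q) (inj (trans e (sym cq))) cj))
                 (subst (λ x → C x (c j) ≡ true) cq (edge q j cj))

  neighbour-of-u-via-a : ∀ {k} {c : Fin (suc (suc k)) → Fin n} → IsCycle C (suc (suc k)) c →
    ∀ {q j} → c q ≡ u → Consecutive (suc (suc k)) q j → H u (c j) ≡ false → H a (c j) ≡ true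
  neighbour-of-u-via-a cyc cq cj ¬u with neighbour-of-u cyc cq cj
  ... | inj₁ h = ⊥-elim (≡true⇒≢false h ¬u)
  ... | inj₂ h = h

  module Insertion {k} (c : Fin (4 + k) → Fin n) (cyc : IsCycle C (4 + k) c) (c≢a : ∀ i → c i ≢ a)
                   {q r : Fin (4 + k)} (end-q : End (4 + k) q) (end-r : End (4 + k) r) (q≢r : q ≢ r)
                   (cq : c q ≡ u) (¬u-r : H u (c r) ≡ false)
                   (¬a-near : ∀ j → Consecutive (4 + k) q j → j ≢ r → H a (c j) ≡ false) where

    near-u : ∀ j → Consecutive (4 + k) q j → j ≢ r → H u (c j) ≡ true
    near-u j cj j≢r with neighbour-of-u cyc cq cj
    ... | inj₁ h = h
    ... | inj₂ h = ⊥-elim (≡true⇒≢false h (¬a-near j cj j≢r))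

    insertion-isCycle : IsCycle H (5 + k) (a ∷ c)
    insertion-isCycle = cons-isCycle H-sym {a = a} {p = c} (proj₁ cyc) c≢a path-edge end-edge
      where
      ≢u : ∀ {j} → j ≢ q → c j ≢ u
      ≢u j≢q e = j≢q (proj₁ cyc (trans e (sym cq)))
      path-edge : ∀ i j → PathConsecutive (4 + k) i j → H (c i) (c j) ≡ true
      path-edge i j pc with i ≟ q | j ≟ q
      ... | yes refl | _ = subst (λ x → H x (c j) ≡ true) (sym cq)
            (near-u j (path⇒consecutive pc) λ { refl → ends-¬pathConsecutive end-q end-r q≢r pc })
      ... | no _ | yes refl = trans (H-sym (c i) (c j)) (subst (λ x → H x (c i) ≡ true) (sym cq)
            (near-u i (path⇒consecutive (swap pc))
                    λ { refl → ends-¬pathConsecutive end-q end-r q≢r (swap pc) }))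
      ... | no i≢q | no j≢q =
        trans (sym (contract-away (≢u i≢q) (≢u j≢q))) (proj₂ cyc i j (path⇒consecutive pc))
      end-edge : ∀ j → End (4 + k) j → H a (c j) ≡ true
      end-edge j e with end-cases end-q end-r q≢r e
      ... | inj₁ refl = subst (λ x → H a x ≡ true) (sym cq) H-au
      ... | inj₂ refl = neighbour-of-u-via-a cyc cq (ends-consecutive end-q end-r q≢r) ¬u-r

    insertion-chord : HasChord C (4 + k) c
    insertion-chord
      with cons-chord-cases H-sym {p = c} (chordal-elim {R = H} H-chordal (suc k) (a ∷ c) insertion-isCycle)
    ... | inj₁ (j , ¬end , h) =
      q , j , (λ { refl → ¬end end-q }) , nonconsecutive , subst (λ x → C x (c j) ≡ true) (sym cq) (contract-at h)
      where
      nonconsecutive : ¬ Consecutive (4 + k) q j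
      nonconsecutive cj with j ≟ r
      ... | yes refl = ¬end end-r
      ... | no j≢r   = ≡true⇒≢false h (¬a-near j cj j≢r)
    ... | inj₂ (i , j , i≢j , ¬pc , h) with consecutive? _ i j
    ...   | no ¬c = i , j , i≢j , ¬c , contract-⊇ h
    ...   | yes cij with consecutive⇒path⊎ends cij
    ...     | inj₁ pc = ⊥-elim (¬pc pc)
    ...     | inj₂ (end-i , end-j) =
                ⊥-elim (boundary (end-cases end-q end-r q≢r end-i) (end-cases end-q end-r q≢r end-j))
      where
      ¬u-r′ : H (c q) (c r) ≢ true
      ¬u-r′ h′ = ≡true⇒≢false (subst (λ x → H x (c r) ≡ true) cq h′) ¬u-r
      boundary : i ≡ q ⊎ i ≡ r → j ≡ q ⊎ j ≡ r → ⊥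
      boundary (inj₁ refl) (inj₁ refl) = i≢j refl
      boundary (inj₂ refl) (inj₂ refl) = i≢j refl
      boundary (inj₁ refl) (inj₂ refl) = ¬u-r′ h
      boundary (inj₂ refl) (inj₁ refl) = ¬u-r′ (trans (H-sym (c q) (c r)) h)

  -- Each cycle neighbour of u is H-adjacent to u or to a. If both are adjacent to u, c is a cycle of H;
  -- if both are adjacent to a, replacing u by a gives one; otherwise a can be inserted between u and
  -- the neighbour that is not H-adjacent to u.
  chord-through-u : ∀ {k} (c : Fin (4 + k) → Fin n) → IsCycle C (4 + k) c → (∀ i → c i ≢ a) →
    c zero ≡ u → HasChord C (4 + k) c
  chord-through-u {k} c cyc@(inj , _) c≢a c0
    with H u (c (suc zero)) in u₁ | H u (c (fromℕ (3 + k))) in uₗ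
       | H a (c (suc zero)) in a₁ | H a (c (fromℕ (3 + k))) in aₗ
  ... | true | true | _ | _ =
    replace-head-chord c cyc c0 u (λ _ → contract-⊇) (λ i e → Fin.0≢1+n (sym (inj (trans e (sym c0)))))
                       (neighbours-zero-elim (λ j → H u (c j) ≡ true) u₁ uₗ)
  ... | _ | _ | true | true =
    replace-head-chord c cyc c0 a (λ _ → contract-at) (c≢a ∘ suc) (neighbours-zero-elim (λ j → H a (c j) ≡ true) a₁ aₗ)
  ... | _ | false | false | _ =
    Insertion.insertion-chord c cyc c≢a (inj₁ refl) (fromℕ-end (3 + k)) (λ ()) c0 uₗ near
    where
    near : ∀ j → Consecutive (4 + k) zero j → j ≢ fromℕ (3 + k) → H a (c j) ≡ false
    near j cj j≢ℓ with neighbours-zero cj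
    ... | inj₁ refl = a₁
    ... | inj₂ refl = ⊥-elim (j≢ℓ refl)
  ... | false | _ | _ | false = unrotate-chord {R = C} {c = c} 1
    (Insertion.insertion-chord (c ∘ next) (rotate-isCycle {R = C} 1 cyc) (c≢a ∘ next)
       (fromℕ-end (3 + k)) (inj₁ refl) (λ ()) (trans (cong c (next-last (3 + k))) c0)
       (trans (cong (λ x → H u (c x)) (next-zero (2 + k))) u₁) near)
    where
    near : ∀ j → Consecutive (4 + k) (fromℕ (3 + k)) j → j ≢ zero → H a (c (next j)) ≡ false
    near j cj j≢0
      with neighbours-zero (subst (λ x → Consecutive _ x (next j)) (next-last (3 + k)) (consecutive-rotate 1 cj))
    ... | inj₁ e = ⊥-elim (j≢0 (next-injective (trans e (sym (next-zero (2 + k))))))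
    ... | inj₂ e = trans (cong (λ x → H a (c x)) e) aₗ
  ... | true | false | true | false =
    ⊥-elim (≡true⇒≢false (neighbour-of-u-via-a cyc c0 (ends-consecutive (inj₁ refl) (fromℕ-end (3 + k)) (λ ())) uₗ) aₗ)
  ... | false | true | false | true =
    ⊥-elim (≡true⇒≢false (neighbour-of-u-via-a cyc c0 (inj₁ refl) u₁) a₁)

  contract-chordal-avoiding-a : ∀ k (c : Fin (4 + k) → Fin n) → IsCycle C (4 + k) c → (∀ i → c i ≢ a) →
    HasChord C (4 + k) c
  contract-chordal-avoiding-a k c cyc c≢a with any? (λ i → c i ≟ u)
  ... | yes (p , cp) = unrotate-chord {R = C} {c = c} (toℕ p)
    (chord-through-u (c ∘ rotate (toℕ p)) (rotate-isCycle {R = C} (toℕ p) cyc) (c≢a ∘ rotate (toℕ p))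
                     (trans (cong c (rotate-zero p)) cp))
  ... | no none with chordal-elim {R = H} H-chordal k c (proj₁ cyc , H-edge)
    where
    H-edge : ∀ i j → Consecutive (4 + k) i j → H (c i) (c j) ≡ true
    H-edge i j cij = trans (sym (contract-away (λ e → none (i , e)) (λ e → none (j , e)))) (proj₂ cyc i j cij)
  ... | i , j , i≢j , ¬c , h = i , j , i≢j , ¬c , contract-⊇ h

-- Breadth-first layers around u in the graph H with a removed

module Reachability {n} (H : Rel n) (a u : Fin n) where

  Within : ℕ → Fin n → Set
  Within zero    x = x ≡ u
  Within (suc i) x = Within i x ⊎ (x ≢ a × ∃[ y ] (Within i y × H y x ≡ true))

  within? : ∀ i x → Dec (Within i x)
  within? zero    x = x ≟ u
  within? (suc i) x = within? i x ⊎-dec (¬? (x ≟ a) ×-dec any? λ y → within? i y ×-dec (H y x Bool.≟ true))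

  within-step : ∀ {i x y} → Within i x → H x y ≡ true → y ≢ a → Within (suc i) y
  within-step w h y≢a = inj₂ (y≢a , _ , w , h)

  unreachable-a : u ≢ a → ∀ i → ¬ Within i a
  unreachable-a u≢a zero    a≡u             = u≢a (sym a≡u)
  unreachable-a u≢a (suc i) (inj₁ w)        = unreachable-a u≢a i w
  unreachable-a u≢a (suc i) (inj₂ (a≢a , _)) = a≢a refl

  FirstAt : ℕ → Fin n → Set
  FirstAt i x = Within i x × (∀ {j} → j < i → ¬ Within j x)

  first-unique : ∀ {i j x} → FirstAt i x → FirstAt j x → i ≡ j
  first-unique {i} {j} (wi , fi) (wj , fj) with <-cmp i j
  ... | tri< i<j _ _ = ⊥-elim (fj i<j wi)
  ... | tri≈ _ i≡j _ = i≡j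
  ... | tri> _ _ j<i = ⊥-elim (fi j<i wj)

  record Geodesic (i : ℕ) (y : Fin n) : Set where
    field
      vertex       : ℕ → Fin n
      vertex-end   : vertex i ≡ y
      vertex-first : ∀ {j} → j ≤ i → FirstAt j (vertex j)
      vertex-edge  : ∀ {j} → j < i → H (vertex j) (vertex (suc j)) ≡ true

  geodesic : ∀ i y → FirstAt i y → Geodesic i y
  geodesic zero y first = record
    { vertex = λ _ → y ; vertex-end = refl ; vertex-first = λ { z≤n → first } ; vertex-edge = λ () }
  geodesic (suc i) y (w , first) with w
  ... | inj₁ w′ = ⊥-elim (first ≤-refl w′)
  ... | inj₂ (y≢a , z , wz , hzy) = record
    { vertex = vertex′ ; vertex-end = at-end ; vertex-first = first′ ; vertex-edge = edge′ }
    where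
    open Geodesic (geodesic i z (wz , λ j<i wjz → first (s≤s j<i) (within-step wjz hzy y≢a)))
    vertex′ : ℕ → Fin n
    vertex′ j with j ≤? i
    ... | yes _ = vertex j
    ... | no  _ = y
    below : ∀ {j} → j ≤ i → vertex′ j ≡ vertex j
    below {j} j≤i with j ≤? i
    ... | yes _   = refl
    ... | no  j≰i = ⊥-elim (j≰i j≤i)
    at-end : vertex′ (suc i) ≡ y
    at-end with suc i ≤? i
    ... | yes i+1≤i = ⊥-elim (<-irrefl refl i+1≤i)
    ... | no  _     = refl
    first′ : ∀ {j} → j ≤ suc i → FirstAt j (vertex′ j)
    first′ {j} j≤i+1 with m≤n⇒m<n∨m≡n j≤i+1
    ... | inj₁ (s≤s j≤i) = subst (FirstAt j) (sym (below j≤i)) (vertex-first j≤i)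
    ... | inj₂ refl      = subst (FirstAt (suc i)) (sym at-end) (w , first)
    edge′ : ∀ {j} → j < suc i → H (vertex′ j) (vertex′ (suc j)) ≡ true
    edge′ {j} (s≤s j≤i) with m≤n⇒m<n∨m≡n j≤i
    ... | inj₁ j<i = subst₂ (λ x x′ → H x x′ ≡ true) (sym (below j≤i)) (sym (below j<i)) (vertex-edge j<i)
    ... | inj₂ refl = subst₂ (λ x x′ → H x x′ ≡ true) (sym (trans (below ≤-refl) vertex-end)) (sym at-end) hzy

module CommonNeighbour {n} {H : Rel n} (H-sym : ∀ x y → H x y ≡ H y x) (H-chordal : Chordal H)
                       {a u : Fin n} (u≢a : u ≢ a) (H-au : H a u ≡ true) where

  open Reachability H a u

  Candidate : Fin n → Set
  Candidate y = H a y ≡ true × y ≢ u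

  candidate-within? : ∀ i → Dec (∃[ y ] (Within i y × Candidate y))
  candidate-within? i = any? λ y → within? i y ×-dec ((H a y Bool.≟ true) ×-dec ¬? (y ≟ u))

  nearest-candidate-not-far : ∀ {k y} → FirstAt (2 + k) y → Candidate y →
    (∀ {j} → j < 2 + k → ¬ (∃[ x ] (Within j x × Candidate x))) → ⊥
  nearest-candidate-not-far {k} {y} first (a-y , _) nearest =
    no-hole H-sym H-chordal {a = a} p inj p≢a path nonpath end inner
    where
    open Geodesic (geodesic (2 + k) y first)
    p : Fin (3 + k) → Fin n
    p j = vertex (toℕ j)
    p-first : ∀ j → FirstAt (toℕ j) (p j)
    p-first j = vertex-first (s≤s⁻¹ (toℕ<n j))
    inj : Injective _≡_ _≡_ p
    inj e = toℕ-injective (first-unique (p-first _) (subst (FirstAt _) (sym e) (p-first _)))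
    p≢a : ∀ j → p j ≢ a
    p≢a j e = unreachable-a u≢a (toℕ j) (subst (Within _) e (proj₁ (p-first j)))
    path : ∀ i j → PathConsecutive (3 + k) i j → H (p i) (p j) ≡ true
    path i j (inj₁ e) = subst (λ t → H (p i) (vertex t) ≡ true) e
                              (vertex-edge (subst (_≤ 2 + k) (sym e) (s≤s⁻¹ (toℕ<n j))))
    path i j (inj₂ e) = trans (H-sym (p i) (p j)) (path j i (inj₁ e))
    far : ∀ i j → 2 + toℕ i ≤ toℕ j → H (p i) (p j) ≡ false
    far i j gap = Bool.¬-not λ h → proj₂ (p-first j) gap (within-step (proj₁ (p-first i)) h (p≢a j))
    nonpath : ∀ i j → i ≢ j → ¬ PathConsecutive (3 + k) i j → H (p i) (p j) ≡ false
    nonpath i j i≢j ¬pc with <-cmp (toℕ i) (toℕ j)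
    ... | tri< i<j _ _ = far i j (≤∧≢⇒< i<j (¬pc ∘ inj₁))
    ... | tri≈ _ e _   = ⊥-elim (i≢j (toℕ-injective e))
    ... | tri> _ _ j<i = trans (H-sym (p i) (p j)) (far j i (≤∧≢⇒< j<i (¬pc ∘ inj₂)))
    end : ∀ j → End (3 + k) j → H a (p j) ≡ true
    end j (inj₁ j≡0) = subst (λ x → H a x ≡ true) (sym (subst (λ t → Within t (p j)) j≡0 (proj₁ (p-first j))))
                             H-au
    end j (inj₂ j≡l) = subst (λ x → H a x ≡ true) (sym (trans (cong vertex (suc-injective j≡l)) vertex-end)) a-y
    inner : ∀ j → ¬ End (3 + k) j → H a (p j) ≡ false
    inner j ¬end = Bool.¬-not λ h → nearest (≤∧≢⇒< (s≤s⁻¹ (toℕ<n j)) (¬end ∘ inj₂ ∘ cong suc))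
                                             (p j , proj₁ (p-first j) , h , p≢u)
      where
      p≢u : p j ≢ u
      p≢u e = proj₂ (p-first j) (n≢0⇒n>0 (¬end ∘ inj₁)) e

  nearest-candidate-adjacent : ∀ {i y} → FirstAt i y → Candidate y →
    (∀ {j} → j < i → ¬ (∃[ x ] (Within j x × Candidate x))) → H u y ≡ true
  nearest-candidate-adjacent {zero} (y≡u , _) (_ , y≢u) _ = ⊥-elim (y≢u y≡u)
  nearest-candidate-adjacent {suc zero} {y} first _ _ =
    subst₂ (λ x x′ → H x x′ ≡ true) (proj₁ (vertex-first z≤n)) vertex-end (vertex-edge (s≤s z≤n))
    where open Geodesic (geodesic 1 y first)
  nearest-candidate-adjacent {suc (suc k)} first cand nearest = ⊥-elim (nearest-candidate-not-far first cand nearest)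

  reachable-candidate⇒common-neighbour : ∀ {N y} → Within N y → Candidate y →
    ∃[ w ] (H a w ≡ true × H u w ≡ true)
  reachable-candidate⇒common-neighbour w c with least candidate-within? (_ , w , c)
  ... | i , (y , wy , cy) , nearest =
    y , proj₁ cy , nearest-candidate-adjacent (wy , λ j<i wj → nearest j<i (y , wj , cy)) cy nearest

-- Reachability is decided only up to double negation, which is enough for a negative conclusion.
unreachable-separates : ∀ {n} (G : Graph n) {H : Rel n} → (∀ x y → Adj G x y ≡ true → H x y ≡ true) →
  ∀ {a u v : Fin n} → u ≢ a → v ≢ a → (∀ N → ¬ Reachability.Within H a u N v) →
  ¬ ¬ IsSeparationClique G (singleton a)
unreachable-separates G {H} G⊆H {a} {u} {v} u≢a v≢a unreachable-v ¬sep =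
  ¬¬-decide Reachable λ reachable? → ¬sep (separation reachable?)
  where
  open Reachability H a u
  Reachable : Fin _ → Set
  Reachable x = ∃[ N ] Within N x
  ≢a : ∀ {x} → singleton a x ≡ false → x ≢ a
  ≢a {x} sx e = ≡true⇒≢false (⌊⌋-true (x ≟ a) e) sx
  separation : (∀ x → Dec (Reachable x)) → IsSeparationClique G (singleton a)
  separation reachable? = clique , side , (u , ⌊⌋-false (u ≟ a) u≢a , ⌊⌋-true (reachable? u) (0 , refl)) ,
                          (v , ⌊⌋-false (v ≟ a) v≢a , ⌊⌋-false (reachable? v) λ (N , w) → unreachable-v N w) , cut
    where
    clique : IsClique G (singleton a)
    clique x y sx sy x≢y = ⊥-elim (x≢y (trans (⌊⌋-sound (x ≟ a) sx) (sym (⌊⌋-sound (y ≟ a) sy))))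
    side : Fin _ → Bool
    side x = ⌊ reachable? x ⌋
    cut : ∀ x y → singleton a x ≡ false → singleton a y ≡ false → side x ≡ true → side y ≡ false →
      Adj G x y ≡ false
    cut x y _ sy rx ry = Bool.¬-not λ adj →
      let (N , w) = ⌊⌋-sound (reachable? x) rx in
      ≡true⇒≢false (⌊⌋-true (reachable? y) (suc N , within-step w (G⊆H x y adj) (≢a sy))) ry

-- Counting pairs

ind : Bool → ℕ
ind b = if b then 1 else 0

ind-mono : ∀ {b c} → (b ≡ true → c ≡ true) → ind b ≤ ind c
ind-mono {false} _ = z≤n
ind-mono {true}  h rewrite h refl = ≤-refl

ind-∧-∨ : ∀ b r s → ind (b ∧ (r ∨ s)) ≤ ind (b ∧ r) + ind (b ∧ s)
ind-∧-∨ false _     _     = z≤n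
ind-∧-∨ true  true  _     = s≤s z≤n
ind-∧-∨ true  false true  = s≤s z≤n
ind-∧-∨ true  false false = z≤n

ind-∧-∨-disjoint : ∀ b r s → (r ≡ true → s ≡ false) → ind (b ∧ (r ∨ s)) ≡ ind (b ∧ r) + ind (b ∧ s)
ind-∧-∨-disjoint false _     _ _ = refl
ind-∧-∨-disjoint true  true  s h rewrite h refl = refl
ind-∧-∨-disjoint true  false _ _ = refl

count : ∀ {n} → (Fin n → Bool) → ℕ
count {n} Z = ∑[ x < n ] ind (Z x)

weight : ∀ {n} → Rel n → Fin n → Fin n → ℕ
weight R x y = ind ((toℕ x <ᵇ toℕ y) ∧ R x y)

pairCount : ∀ {n} → Rel n → ℕ
pairCount {n} R = ∑[ x < n ] ∑[ y < n ] weight R x y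

∑-mono : ∀ {n} {f g : Fin n → ℕ} → (∀ i → f i ≤ g i) → ∑[ i < n ] f i ≤ ∑[ i < n ] g i
∑-mono {zero}  _   = z≤n
∑-mono {suc n} f≤g = +-mono-≤ (f≤g zero) (∑-mono (f≤g ∘ suc))

∑-zero : ∀ {n} {f : Fin n → ℕ} → (∀ i → f i ≡ 0) → ∑[ i < n ] f i ≡ 0
∑-zero {n} f≡0 = trans (sum-cong-≗ f≡0) (sum-replicate-zero n)

∑-delta : ∀ {n} {f : Fin n → ℕ} (c : Fin n) → (∀ i → i ≢ c → f i ≡ 0) → ∑[ i < n ] f i ≡ f c
∑-delta {suc n} {f} c f≡0 = begin
  sum f                     ≡⟨ sum-remove {i = c} f ⟩
  f c + sum (removeAt f c)  ≡⟨ cong (f c +_) (∑-zero λ j → f≡0 _ (punchInᵢ≢i c j)) ⟩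
  f c + 0                   ≡⟨ +-identityʳ (f c) ⟩
  f c                       ∎
  where open ≡-Reasoning

∑∑-distrib-+ : ∀ {n} (f g : Fin n → Fin n → ℕ) →
  ∑[ x < n ] ∑[ y < n ] (f x y + g x y) ≡ ∑[ x < n ] ∑[ y < n ] f x y + ∑[ x < n ] ∑[ y < n ] g x y
∑∑-distrib-+ {n} f g =
  trans (sum-cong-≗ λ x → ∑-distrib-+ (f x) (g x))
        (∑-distrib-+ (λ x → ∑[ y < n ] f x y) (λ x → ∑[ y < n ] g x y))

listSum-tabulate : ∀ {n} (f : Fin n → ℕ) → listSum (tabulate f) ≡ ∑[ i < n ] f i
listSum-tabulate {zero}  f = refl
listSum-tabulate {suc n} f = cong (f zero +_) (listSum-tabulate (f ∘ suc))

listSum-allFin : ∀ {n} (f : Fin n → ℕ) → listSum (map f (allFin n)) ≡ ∑[ i < n ] f i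
listSum-allFin f = trans (cong listSum (map-tabulate id f)) (listSum-tabulate f)

listSum-cartesianProduct : ∀ {A B : Set} (f : A × B → ℕ) (xs : List A) (ys : List B) →
  listSum (map f (cartesianProduct xs ys)) ≡ listSum (map (λ x → listSum (map (λ y → f (x , y)) ys)) xs)
listSum-cartesianProduct f L.[]       ys = refl
listSum-cartesianProduct f (x L.∷ xs) ys = begin
  listSum (map f (map (x ,_) ys ++ cartesianProduct xs ys))
    ≡⟨ cong listSum (map-++ f (map (x ,_) ys) _) ⟩
  listSum (map f (map (x ,_) ys) ++ map f (cartesianProduct xs ys))
    ≡⟨ sum-++ (map f (map (x ,_) ys)) _ ⟩
  listSum (map f (map (x ,_) ys)) + listSum (map f (cartesianProduct xs ys))
    ≡⟨ cong₂ _+_ (cong listSum (sym (map-∘ ys))) (listSum-cartesianProduct f xs ys) ⟩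
  listSum (map (λ y → f (x , y)) ys) + listSum (map (λ x → listSum (map (λ y → f (x , y)) ys)) xs)
    ∎
  where open ≡-Reasoning

size≡pairCount : ∀ {n} (T : PairSet n) → size T ≡ pairCount (proj₁ T)
size≡pairCount {n} (T , T-pairs) = begin
  size (T , T-pairs)
    ≡⟨ listSum-cartesianProduct _ (allFin n) (allFin n) ⟩
  listSum (map (λ x → listSum (map (weight T x) (allFin n))) (allFin n))
    ≡⟨ listSum-allFin (λ x → listSum (map (weight T x) (allFin n))) ⟩
  ∑[ x < n ] listSum (map (weight T x) (allFin n))
    ≡⟨ sum-cong-≗ (λ x → listSum-allFin (weight T x)) ⟩
  pairCount T
    ∎
  where open ≡-Reasoning

_∪ᴿ_ : ∀ {n} → Rel n → Rel n → Rel n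
(R ∪ᴿ S) x y = R x y ∨ S x y

removeVertex : ∀ {n} → Fin n → Rel n → Rel n
removeVertex a R x y = R x y ∧ not (x == a) ∧ not (y == a)

star : ∀ {n} → Fin n → (Fin n → Bool) → Rel n
star c Z x y = (x == c ∧ Z y) ∨ (y == c ∧ Z x)

removeVertex-sym : ∀ {n} {R : Rel n} {a} → (∀ x y → R x y ≡ R y x) →
  ∀ x y → removeVertex a R x y ≡ removeVertex a R y x
removeVertex-sym {a = a} R-sym x y = cong₂ _∧_ (R-sym x y) (Bool.∧-comm (not (x == a)) (not (y == a)))

star-sym : ∀ {n} {c : Fin n} {Z} x y → star c Z x y ≡ star c Z y x
star-sym {c = c} {Z} x y = Bool.∨-comm (x == c ∧ Z y) (y == c ∧ Z x)

star-irr : ∀ {n} {c : Fin n} {Z} → Z c ≡ false → ∀ x → star c Z x x ≡ false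
star-irr {c = c} Zc x with x ≟ c
... | yes refl rewrite Zc = refl
... | no  _    = refl

pairCount-cong : ∀ {n} {R S : Rel n} → (∀ x y → R x y ≡ S x y) → pairCount R ≡ pairCount S
pairCount-cong R≡S = sum-cong-≗ λ x → sum-cong-≗ λ y → cong (λ b → ind ((toℕ x <ᵇ toℕ y) ∧ b)) (R≡S x y)

pairCount-∪ : ∀ {n} (R S : Rel n) → pairCount (R ∪ᴿ S) ≤ pairCount R + pairCount S
pairCount-∪ R S = ≤-trans (∑-mono λ x → ∑-mono λ y → ind-∧-∨ _ (R x y) (S x y))
                          (≤-reflexive (∑∑-distrib-+ (weight R) (weight S)))

pairCount-disjoint-∪ : ∀ {n} (R S : Rel n) → (∀ x y → R x y ≡ true → S x y ≡ false) →
  pairCount (R ∪ᴿ S) ≡ pairCount R + pairCount S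
pairCount-disjoint-∪ R S disjoint =
  trans (sum-cong-≗ λ x → sum-cong-≗ λ y → ind-∧-∨-disjoint _ (R x y) (S x y) (disjoint x y))
        (∑∑-distrib-+ (weight R) (weight S))

<ᵇ-true : ∀ {m n} → m < n → (m <ᵇ n) ≡ true
<ᵇ-true m<n = Equivalence.to Bool.T-≡ (<⇒<ᵇ m<n)

<ᵇ-false : ∀ {m n} → ¬ m < n → (m <ᵇ n) ≡ false
<ᵇ-false m≮n = Bool.¬-not (m≮n ∘ <ᵇ⇒< _ _ ∘ Equivalence.from Bool.T-≡)

pairCount-star : ∀ {n} (c : Fin n) (Z : Fin n → Bool) → Z c ≡ false → pairCount (star c Z) ≡ count Z
pairCount-star {n} c Z Zc = begin
  pairCount (star c Z)
    ≡⟨ sum-cong-≗ (λ x → sum-cong-≗ (split x)) ⟩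
  ∑[ x < n ] ∑[ y < n ] (ind (x == c ∧ after y) + ind (y == c ∧ before x))
    ≡⟨ ∑∑-distrib-+ (λ x y → ind (x == c ∧ after y)) (λ x y → ind (y == c ∧ before x)) ⟩
  ∑[ x < n ] ∑[ y < n ] ind (x == c ∧ after y) + ∑[ x < n ] ∑[ y < n ] ind (y == c ∧ before x)
    ≡⟨ cong₂ _+_ (∑-delta c λ x x≢c → ∑-zero λ y → cong (λ b → ind (b ∧ after y)) (⌊⌋-false (x ≟ c) x≢c))
                 (sum-cong-≗ λ x → ∑-delta c λ y y≢c → cong (λ b → ind (b ∧ before x)) (⌊⌋-false (y ≟ c) y≢c)) ⟩
  ∑[ y < n ] ind (c == c ∧ after y) + ∑[ x < n ] ind (c == c ∧ before x)
    ≡⟨ cong₂ _+_ (sum-cong-≗ λ y → cong (λ b → ind (b ∧ after y)) (⌊⌋-true (c ≟ c) refl))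
                 (sum-cong-≗ λ x → cong (λ b → ind (b ∧ before x)) (⌊⌋-true (c ≟ c) refl)) ⟩
  ∑[ x < n ] ind (after x) + ∑[ x < n ] ind (before x)
    ≡⟨ sym (∑-distrib-+ (ind ∘ after) (ind ∘ before)) ⟩
  ∑[ x < n ] (ind (after x) + ind (before x))
    ≡⟨ sum-cong-≗ either-side ⟩
  count Z
    ∎
  where
  open ≡-Reasoning
  after before : Fin n → Bool
  after  y = (toℕ c <ᵇ toℕ y) ∧ Z y
  before x = (toℕ x <ᵇ toℕ c) ∧ Z x
  split : ∀ x y → weight (star c Z) x y ≡ ind (x == c ∧ after y) + ind (y == c ∧ before x)
  split x y with x ≟ c | y ≟ c
  ... | yes refl | yes refl rewrite Zc | Bool.∧-zeroʳ (toℕ c <ᵇ toℕ c) = refl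
  ... | yes refl | no _     rewrite Bool.∨-identityʳ (Z y) = sym (+-identityʳ _)
  ... | no _     | yes refl = refl
  ... | no _     | no _     rewrite Bool.∧-zeroʳ (toℕ x <ᵇ toℕ y) = refl
  either-side : ∀ x → ind (after x) + ind (before x) ≡ ind (Z x)
  either-side x with Z x in Zx
  ... | false rewrite Bool.∧-zeroʳ (toℕ c <ᵇ toℕ x) | Bool.∧-zeroʳ (toℕ x <ᵇ toℕ c) = refl
  ... | true rewrite Bool.∧-identityʳ (toℕ c <ᵇ toℕ x) | Bool.∧-identityʳ (toℕ x <ᵇ toℕ c)
    with <-cmp (toℕ c) (toℕ x)
  ...   | tri< c<x _ x≮c rewrite <ᵇ-true c<x | <ᵇ-false x≮c = refl
  ...   | tri≈ _ c≡x _ = ⊥-elim (≡true⇒≢false Zx (subst (λ y → Z y ≡ false) (toℕ-injective c≡x) Zc))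
  ...   | tri> c≮x _ x<c rewrite <ᵇ-false c≮x | <ᵇ-true x<c = refl

pairCount-removeVertex : ∀ {n} (R : Rel n) → (∀ x y → R x y ≡ R y x) → (∀ x → R x x ≡ false) → ∀ a →
  pairCount R ≡ pairCount (removeVertex a R) + count (R a)
pairCount-removeVertex R R-sym R-irr a = begin
  pairCount R
    ≡⟨ pairCount-cong decompose ⟩
  pairCount (removeVertex a R ∪ᴿ star a (R a))
    ≡⟨ pairCount-disjoint-∪ (removeVertex a R) (star a (R a)) disjoint ⟩
  pairCount (removeVertex a R) + pairCount (star a (R a))
    ≡⟨ cong (pairCount (removeVertex a R) +_) (pairCount-star a (R a) (R-irr a)) ⟩
  pairCount (removeVertex a R) + count (R a)
    ∎
  where
  open ≡-Reasoning
  decompose : ∀ x y → R x y ≡ (removeVertex a R ∪ᴿ star a (R a)) x y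
  decompose x y with x ≟ a | y ≟ a
  ... | yes refl | yes refl rewrite R-irr x = refl
  ... | yes refl | no _     rewrite Bool.∧-zeroʳ (R x y) | Bool.∨-identityʳ (R x y) = refl
  ... | no _     | yes refl rewrite Bool.∧-zeroʳ (R x y) = R-sym x y
  ... | no _     | no _     rewrite Bool.∧-identityʳ (R x y) | Bool.∨-identityʳ (R x y) = refl
  disjoint : ∀ x y → removeVertex a R x y ≡ true → star a (R a) x y ≡ false
  disjoint x y h with x ≟ a | y ≟ a
  ... | yes refl | _        = ⊥-elim (≡true⇒≢false h (Bool.∧-zeroʳ (R x y)))
  ... | no _     | yes refl = ⊥-elim (≡true⇒≢false h (Bool.∧-zeroʳ (R x y)))
  ... | no _     | no _     = refl

count-exchange : ∀ {n} (Z Z′ : Fin n → Bool) (v : Fin n) → (∀ x → Z x ≡ true → Z′ x ≡ true ⊎ x ≡ v) →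
  (Z v ≡ true → ∃[ w ] (Z′ w ≡ true × Z w ≡ false)) → count Z ≤ count Z′
count-exchange {n} Z Z′ v Z⊆Z′+v exchange with Z v in Zv
... | false = ∑-mono λ x → ind-mono λ Zx → [ id , (λ { refl → ⊥-elim (≡true⇒≢false Zx Zv) }) ] (Z⊆Z′+v x Zx)
... | true with exchange refl
...   | w , Z′w , Zw = +-cancelʳ-≤ 1 (count Z) (count Z′) (begin
  count Z + 1                                  ≡⟨ cong (count Z +_) (sym (indicator w)) ⟩
  count Z + ∑[ x < n ] ind (x == w)            ≡⟨ sym (∑-distrib-+ (ind ∘ Z) (λ x → ind (x == w))) ⟩
  ∑[ x < n ] (ind (Z x) + ind (x == w))        ≤⟨ ∑-mono trade ⟩
  ∑[ x < n ] (ind (Z′ x) + ind (x == v))       ≡⟨ ∑-distrib-+ (ind ∘ Z′) (λ x → ind (x == v)) ⟩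
  count Z′ + ∑[ x < n ] ind (x == v)           ≡⟨ cong (count Z′ +_) (indicator v) ⟩
  count Z′ + 1                                 ∎)
  where
  open ≤-Reasoning
  indicator : ∀ c → ∑[ x < n ] ind (x == c) ≡ 1
  indicator c = trans (∑-delta c λ x x≢c → cong ind (⌊⌋-false (x ≟ c) x≢c)) (cong ind (⌊⌋-true (c ≟ c) refl))
  trade : ∀ x → ind (Z x) + ind (x == w) ≤ ind (Z′ x) + ind (x == v)
  trade x with x ≟ w | x ≟ v
  ... | yes refl | yes refl = ⊥-elim (≡true⇒≢false Zv Zw)
  ... | yes refl | no _     rewrite Zw | Z′w = ≤-refl
  ... | no _     | yes refl rewrite Zv = m≤n+m 1 (ind (Z′ x))
  ... | no _     | no x≢v   rewrite +-identityʳ (ind (Z x)) | +-identityʳ (ind (Z′ x)) =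
    ind-mono λ Zx → [ id , (λ x≡v → ⊥-elim (x≢v x≡v)) ] (Z⊆Z′+v x Zx)

∃-fun? : ∀ {k m} {P : (Fin k → Fin m) → Set} → (∀ {f g} → f ≗ g → P f → P g) →
  (∀ f → Dec (P f)) → Dec (∃ P)
∃-fun? resp P? = map′ (λ (i , p) → finToFun i , p) (λ (f , p) → funToFin f , resp (sym ∘ finToFun-funToFin f) p)
                      (any? (P? ∘ finToFun))

∀-fun? : ∀ {k m} {P : (Fin k → Fin m) → Set} → (∀ {f g} → f ≗ g → P f → P g) →
  (∀ f → Dec (P f)) → Dec (∀ f → P f)
∀-fun? resp P? = map′ (λ all f → resp (finToFun-funToFin f) (all (funToFin f))) (λ all i → all (finToFun i))
                      (all? (P? ∘ finToFun))

bit : Fin 2 → Bool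
bit zero    = false
bit (suc _) = true

fromBit : Bool → Fin 2
fromBit false = zero
fromBit true  = suc zero

bit-fromBit : ∀ b → bit (fromBit b) ≡ b
bit-fromBit false = refl
bit-fromBit true  = refl

∃-rel? : ∀ {n} {P : Rel n → Set} → (∀ {R S} → (∀ x y → R x y ≡ S x y) → P R → P S) →
  (∀ R → Dec (P R)) → Dec (∃ P)
∃-rel? {n} {P} resp P? =
  map′ (λ (rows , p) → decode rows , p) (λ (R , p) → encode R , resp (λ x y → sym (decode-encode R x y)) p)
       (∃-fun? (λ rows≗ → resp λ x y → cong (λ row → bit (finToFun row y)) (rows≗ x)) (P? ∘ decode))
  where
  decode : (Fin n → Fin (2 ^ n)) → Rel n
  decode rows x y = bit (finToFun (rows x) y)
  encode : Rel n → Fin n → Fin (2 ^ n)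
  encode R x = funToFin (fromBit ∘ R x)
  decode-encode : ∀ R x y → decode (encode R) x y ≡ R x y
  decode-encode R x y = trans (cong bit (finToFun-funToFin (fromBit ∘ R x) y)) (bit-fromBit (R x y))

isCycle? : ∀ {n} (R : Rel n) k (c : Fin k → Fin n) → Dec (IsCycle R k c)
isCycle? R k c =
  map′ (λ inj {i} {j} → inj i j) (λ inj i j → inj {i} {j}) (all? λ i → all? λ j → (c i ≟ c j) →-dec (i ≟ j))
  ×-dec all? λ i → all? λ j → consecutive? k i j →-dec (R (c i) (c j) Bool.≟ true)

hasChord? : ∀ {n} (R : Rel n) k (c : Fin k → Fin n) → Dec (HasChord R k c)
hasChord? R k c =
  any? λ i → any? λ j → ¬? (i ≟ j) ×-dec ¬? (consecutive? k i j) ×-dec (R (c i) (c j) Bool.≟ true)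

module _ {n} {R : Rel n} {k} {c c′ : Fin k → Fin n} (c≗c′ : c ≗ c′) where

  isCycle-cong : IsCycle R k c → IsCycle R k c′
  isCycle-cong (inj , edge) = (λ {i} {j} e → inj (trans (c≗c′ i) (trans e (sym (c≗c′ j))))) ,
                              λ i j cij → subst₂ (λ x y → R x y ≡ true) (c≗c′ i) (c≗c′ j) (edge i j cij)

  hasChord-cong : HasChord R k c → HasChord R k c′
  hasChord-cong (i , j , i≢j , ¬c , r) = i , j , i≢j , ¬c , subst₂ (λ x y → R x y ≡ true) (c≗c′ i) (c≗c′ j) r

chordal? : ∀ {n} (R : Rel n) → Dec (Chordal R)
chordal? {n} R = map′ unbounded (λ ch {k} _ → ch k) (allUpTo? chordalAt? (suc n))
  where
  ChordalAt : ℕ → Set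
  ChordalAt k = 4 ≤ k → ∀ c → IsCycle R k c → HasChord R k c
  chordalAt? : ∀ k → Dec (ChordalAt k)
  chordalAt? k = (4 ≤? k) →-dec
    ∀-fun? (λ c≗c′ h → hasChord-cong {R = R} c≗c′ ∘ h ∘ isCycle-cong {R = R} (sym ∘ c≗c′))
           (λ c → isCycle? R k c →-dec hasChord? R k c)
  unbounded : (∀ {k} → k < suc n → ChordalAt k) → ∀ k → ChordalAt k
  unbounded bounded k with k ≤? n
  ... | yes k≤n = bounded (s≤s k≤n)
  ... | no  k≰n = λ _ c (inj , _) → let (i , j , i<j , ci≡cj) = pigeonhole (≰⇒> k≰n) c in
                                    ⊥-elim (Fin.<⇒≢ i<j (inj ci≡cj))

module _ {n} (G : Graph n) where

  private
    Triangulation≤ : ℕ → Set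
    Triangulation≤ m = ∃[ T ] (IsTriangulation G T × size T ≤ m)

    Triangulating≤ : ℕ → Rel n → Set
    Triangulating≤ m R = (∀ x y → R x y ≡ R y x) × (∀ x → R x x ≡ false) ×
                         Chordal (λ x y → Adj G x y ∨ R x y) × pairCount R ≤ m

    triangulating≤-cong : ∀ {m R S} → (∀ x y → R x y ≡ S x y) → Triangulating≤ m R → Triangulating≤ m S
    triangulating≤-cong {m} {R} R≡S (R-sym , R-irr , ch , R≤m) =
      (λ x y → trans (sym (R≡S x y)) (trans (R-sym x y) (R≡S y x))) , (λ x → trans (sym (R≡S x x)) (R-irr x)) ,
      chordal-cong {R = λ x y → Adj G x y ∨ R x y} (λ x y → cong (Adj G x y ∨_) (R≡S x y)) ch ,
      subst (_≤ m) (pairCount-cong R≡S) R≤m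

    triangulation≤? : ∀ m → Dec (Triangulation≤ m)
    triangulation≤? m =
      map′ (λ (R , R-sym , R-irr , ch , R≤m) →
              (R , R-sym , R-irr) , ch , subst (_≤ m) (sym (size≡pairCount (R , R-sym , R-irr))) R≤m)
           (λ ((R , R-sym , R-irr) , ch , T≤m) →
              R , R-sym , R-irr , ch , subst (_≤ m) (size≡pairCount (R , R-sym , R-irr)) T≤m)
           (∃-rel? triangulating≤-cong λ R →
              (all? λ x → all? λ y → R x y Bool.≟ R y x) ×-dec (all? λ x → R x x Bool.≟ false) ×-dec
              chordal? (λ x y → Adj G x y ∨ R x y) ×-dec pairCount R ≤? m)

    complete : PairSet n
    complete = (λ x y → not (x == y)) , (λ x y → cong not (==-sym x y)) , (λ x → cong not (⌊⌋-true (x ≟ x) refl))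

    complete-triangulation : IsTriangulation G complete
    complete-triangulation = complete-chordal {R = G ∪E complete} λ x y x≢y →
      ∨-introʳ (Adj G x y) (cong not (⌊⌋-false (x ≟ y) x≢y))

  minimum-triangulation : ∃ (IsMinimumTriangulation G)
  minimum-triangulation with least triangulation≤? (complete , complete-triangulation , ≤-refl)
  ... | _ , (T , T-tri , T≤m) , none-below =
    T , T-tri , λ T′ T′-tri → ≤-trans T≤m (≮⇒≥ λ T′<m → none-below T′<m (T′ , T′-tri , ≤-refl))

-- The modified triangulation

module Modification {n} (G : Graph n) (R : Rel n) (R-sym : ∀ x y → R x y ≡ R y x) (R-irr : ∀ x → R x x ≡ false)
  (R-tri : IsTriangulation G (R , R-sym , R-irr)) {a u v : Fin n} (u≢v : u ≢ v)
  (G-au : Adj G a u ≡ true) (G-av : Adj G a v ≡ true) (N-a : ∀ x → Adj G a x ≡ true → x ≡ u ⊎ x ≡ v)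
  (G-uv : Adj G u v ≡ false) (nonseparating : ¬ IsSeparationClique G (singleton a)) where

  H : Rel n
  H = G ∪E (R , R-sym , R-irr)

  H-sym : ∀ x y → H x y ≡ H y x
  H-sym x y = cong₂ _∨_ (Graph.sym G x y) (R-sym x y)

  H-irr : ∀ x → H x x ≡ false
  H-irr x = cong₂ _∨_ (irref G x) (R-irr x)

  G⊆H : ∀ x y → Adj G x y ≡ true → H x y ≡ true
  G⊆H x y = ∨-introˡ (R x y)

  ≢a : ∀ {x} → Adj G a x ≡ true → x ≢ a
  ≢a {x} e refl = ≡true⇒≢false e (irref G x)

  fresh : Fin n → Bool
  fresh y = H a y ∧ not (H u y) ∧ not (y == u)

  fresh-u : fresh u ≡ false
  fresh-u rewrite ⌊⌋-true (u ≟ u) refl = trans (cong (H a u ∧_) (Bool.∧-zeroʳ _)) (Bool.∧-zeroʳ _)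

  T̂ : PairSet n
  T̂ = removeVertex a R ∪ᴿ star u fresh , T̂-sym , T̂-irr
    where
    T̂-sym : ∀ x y → (removeVertex a R ∪ᴿ star u fresh) x y ≡ (removeVertex a R ∪ᴿ star u fresh) y x
    T̂-sym x y = cong₂ _∨_ (removeVertex-sym R-sym x y) (star-sym x y)
    T̂-irr : ∀ x → (removeVertex a R ∪ᴿ star u fresh) x x ≡ false
    T̂-irr x = cong₂ _∨_ (cong (_∧ _) (R-irr x)) (star-irr fresh-u x)

  T̂-a : ∀ x → proj₁ T̂ a x ≡ false
  T̂-a x rewrite ⌊⌋-true (a ≟ a) refl | ⌊⌋-false (a ≟ u) (≢a G-au ∘ sym) | H-irr a =
    cong₂ _∨_ (Bool.∧-zeroʳ (R a x)) (Bool.∧-zeroʳ (x == u))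

  T̂-uv : proj₁ T̂ u v ≡ true
  T̂-uv with R u v in R-uv
  ... | true  rewrite ⌊⌋-false (u ≟ a) (≢a G-au) | ⌊⌋-false (v ≟ a) (≢a G-av) = refl
  ... | false rewrite ⌊⌋-true (u ≟ u) refl | G-av | G-uv | ⌊⌋-false (v ≟ u) (u≢v ∘ sym) = refl

  -- The two Boolean identities below are stated in the normal forms that T̂-contracts reaches.
  absorbˡ : ∀ p q r → p ∨ (q ∨ ((r ∧ not (p ∨ q) ∧ true) ∨ false)) ≡ (p ∨ q) ∨ (r ∨ false)
  absorbˡ true  _     _     = refl
  absorbˡ false true  _     = refl
  absorbˡ false false true  = refl
  absorbˡ false false false = refl

  absorbʳ : ∀ p q r → p ∨ (q ∨ (r ∧ not (p ∨ q) ∧ true)) ≡ (p ∨ q) ∨ r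
  absorbʳ true  _     _     = refl
  absorbʳ false true  _     = refl
  absorbʳ false false true  = refl
  absorbʳ false false false = refl

  T̂-contracts : ∀ x y → x ≢ y → x ≢ a → y ≢ a → (G ∪E T̂) x y ≡ contract H a u x y
  T̂-contracts x y x≢y x≢a y≢a
    rewrite ⌊⌋-false (x ≟ a) x≢a | ⌊⌋-false (y ≟ a) y≢a | Bool.∧-identityʳ (R x y)
    with x ≟ u | y ≟ u
  ... | yes refl | yes refl = ⊥-elim (x≢y refl)
  ... | yes refl | no _     = absorbˡ (Adj G x y) (R x y) (H a y)
  ... | no _     | yes refl rewrite Graph.sym G y x | R-sym y x = absorbʳ (Adj G x y) (R x y) (H a x)
  ... | no _     | no _     = sym (Bool.∨-assoc (Adj G x y) (R x y) false)

  T̂-triangulation : IsTriangulation G T̂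
  T̂-triangulation = chordal-by-vertex {R = R̂} a
    (λ k c cyc c0 → simplicial-chord {R = R̂} clique cyc c0)
    (chordal-avoiding-transfer {R = R̂} {S = contract H a u} T̂-contracts
      (ContractionChordal.contract-chordal-avoiding-a H-sym R-tri (G⊆H a u G-au)))
    where
    R̂ : Rel n
    R̂ = G ∪E T̂
    R̂-uv : R̂ u v ≡ true
    R̂-uv = ∨-introʳ (Adj G u v) T̂-uv
    N̂-a : ∀ x → R̂ a x ≡ true → x ≡ u ⊎ x ≡ v
    N̂-a x e = N-a x (trans (sym (Bool.∨-identityʳ (Adj G a x))) (trans (cong (Adj G a x ∨_) (sym (T̂-a x))) e))
    clique : ∀ x y → x ≢ y → R̂ a x ≡ true → R̂ a y ≡ true → R̂ x y ≡ true
    clique x y x≢y ax ay with N̂-a x ax | N̂-a y ay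
    ... | inj₁ refl | inj₁ refl = ⊥-elim (x≢y refl)
    ... | inj₂ refl | inj₂ refl = ⊥-elim (x≢y refl)
    ... | inj₁ refl | inj₂ refl = R̂-uv
    ... | inj₂ refl | inj₁ refl = trans (cong₂ _∨_ (Graph.sym G v u) (proj₁ (proj₂ T̂) v u)) R̂-uv

  common-neighbour : ∃[ w ] (H a w ≡ true × H u w ≡ true)
  common-neighbour = decidable-stable (any? λ w → (H a w Bool.≟ true) ×-dec (H u w Bool.≟ true)) λ none →
    unreachable-separates G G⊆H (≢a G-au) (≢a G-av)
      (λ N w → none (reachable-candidate⇒common-neighbour w (G⊆H a v G-av , u≢v ∘ sym))) nonseparating
    where open CommonNeighbour H-sym R-tri (≢a G-au) (G⊆H a u G-au)

  fresh-exchange : count fresh ≤ count (R a)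
  fresh-exchange = count-exchange fresh (R a) v into exchange
    where
    into : ∀ x → fresh x ≡ true → R a x ≡ true ⊎ x ≡ v
    into x fx with ∨-elim (Bool.∧-conicalˡ _ _ fx)
    ... | inj₂ R-ax = inj₁ R-ax
    ... | inj₁ G-ax with N-a x G-ax
    ...   | inj₂ x≡v  = inj₂ x≡v
    ...   | inj₁ refl = ⊥-elim (≡true⇒≢false (Bool.∧-conicalʳ (not (H u x)) _ (Bool.∧-conicalʳ (H a x) _ fx))
                                             (cong not (⌊⌋-true (x ≟ x) refl)))
    exchange : fresh v ≡ true → ∃[ w ] (R a w ≡ true × fresh w ≡ false)
    exchange fv with common-neighbour
    ... | w , a-w , u-w = w , R-aw , fresh-w
      where
      H-uv : H u v ≡ false
      H-uv = trans (sym (Bool.not-involutive (H u v)))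
                   (cong not (Bool.∧-conicalˡ _ (not (v == u)) (Bool.∧-conicalʳ (H a v) _ fv)))
      fresh-w : fresh w ≡ false
      fresh-w rewrite u-w = Bool.∧-zeroʳ (H a w)
      R-aw : R a w ≡ true
      R-aw with ∨-elim a-w
      ... | inj₂ r = r
      ... | inj₁ G-aw with N-a w G-aw
      ...   | inj₁ refl = ⊥-elim (≡true⇒≢false u-w (H-irr w))
      ...   | inj₂ refl = ⊥-elim (≡true⇒≢false u-w H-uv)

  T̂-smaller : size T̂ ≤ size (R , R-sym , R-irr)
  T̂-smaller = begin
    size T̂                                           ≡⟨ size≡pairCount T̂ ⟩
    pairCount (R∖a ∪ᴿ star u fresh)                  ≤⟨ pairCount-∪ R∖a (star u fresh) ⟩
    pairCount R∖a + pairCount (star u fresh)         ≡⟨ cong (pairCount R∖a +_) (pairCount-star u fresh fresh-u) ⟩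
    pairCount R∖a + count fresh                      ≤⟨ +-monoʳ-≤ (pairCount R∖a) fresh-exchange ⟩
    pairCount R∖a + count (R a)                      ≡⟨ sym (pairCount-removeVertex R R-sym R-irr a) ⟩
    pairCount R                                      ≡⟨ sym (size≡pairCount (R , R-sym , R-irr)) ⟩
    size (R , R-sym , R-irr)                         ∎
    where
    open ≤-Reasoning
    R∖a : Rel n
    R∖a = removeVertex a R

lemma8 : ∀ {n : ℕ} (G : Graph n) (a u v : Fin n) →
    u ≢ v → Adj G a u ≡ true → Adj G a v ≡ true →
    (∀ x → Adj G a x ≡ true → x ≡ u ⊎ x ≡ v) →
    Adj G u v ≡ false →
    ¬ IsSeparationClique G (singleton a) →
    ∃[ T ] (IsMinimumTriangulation G T × (u , v) ∈ₚ T × (∀ x → ¬ ((a , x) ∈ₚ T)))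
lemma8 G a u v u≢v G-au G-av N-a G-uv nonseparating with minimum-triangulation G
... | (R , R-sym , R-irr) , R-tri , R-minimum =
  T̂ , (T̂-triangulation , λ T′ T′-tri → ≤-trans T̂-smaller (R-minimum T′ T′-tri)) , T̂-uv ,
  λ x a-x → ≡true⇒≢false a-x (T̂-a x)
  where open Modification G R R-sym R-irr R-tri u≢v G-au G-av N-a G-uv nonseparating
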